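{- Let $n\geq 2$ be an integer. Then $$\binom{n^3-\lfloor\frac{(n-1)^3+1}{2}\rfloor}{3n^2-3n+1}+\binom{n^3-\lfloor\frac{(n-1)^3+2}{2}\rfloor}{3n^2-3n+1}< \frac{1}{n^3}\binom{n^3+6n^2-6n+2}{n^3-1}.$$ -}

module Defs where

open import Data.Nat using (ℕ; _+_; _*_; _∸_; _^_; _/_)

-- k = 3n² - 3n + 1 (truncated subtraction is exact since 3n² ≥ 3n)
kk : ℕ → ℕ
kk n = 3 * n ^ 2 ∸ 3 * n + 1

fl1 : ℕ → ℕ
fl1 n = ((n ∸ 1) ^ 3 + 1) / 2

fl2 : ℕ → ℕ
fl2 n = ((n ∸ 1) ^ 3 + 2) / 2

module Submission where

open import Defs
open import Data.Nat using (ℕ; zero; suc; _+_; _*_; _∸_; _^_; _≤_; _<_; z≤n; s≤s; _≤′_; ≤′-refl; ≤′-step; NonZero; >-nonZero)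
open import Data.Nat.Properties
open import Data.Nat.Combinatorics using (_C_; nCk+nC[k+1]≡[n+1]C[k+1]; nCn≡1; nC1≡n; nCk≡nC[n∸k])
open import Data.Nat.Tactic.RingSolver using (solve-∀)
open import Relation.Binary.PropositionalEquality

-- Write N = n³, m = (n-1)³ and k = 3n² - 3n + 1, so that N = m + k, the upper
-- index on the right is N + 2k and the lower one is N - 1 = m + (k - 1).
-- Both binomials on the left are at most C(N,k) = C(N,m).  The superadditivity
-- C(a,i) C(b,j) ≤ C(a+b,i+j) gives C(k+1,2) ≤ C(2k,k-1) and then
-- C(N,m) C(2k,k-1) ≤ C(N+2k, m+k-1), so it suffices that 2N < C(k+1,2),
-- which holds because k is of order 3n² while N = n³.

nCk≤[1+n]Ck : ∀ n k → n C k ≤ suc n C k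
nCk≤[1+n]Ck n zero    = ≤-refl
nCk≤[1+n]Ck n (suc k) rewrite sym (nCk+nC[k+1]≡[n+1]C[k+1] n k) = m≤n+m (n C suc k) (n C k)

C-monoˡ-≤ : ∀ {m n} k → m ≤ n → m C k ≤ n C k
C-monoˡ-≤ {m} k m≤n = go (≤⇒≤′ m≤n)
  where
  go : ∀ {n} → m ≤′ n → m C k ≤ n C k
  go ≤′-refl       = ≤-refl
  go (≤′-step m≤n) = ≤-trans (go m≤n) (nCk≤[1+n]Ck _ k)

k≤n⇒nCk>0 : ∀ {n k} → k ≤ n → 0 < n C k
k≤n⇒nCk>0 {n} {k} k≤n = begin-strict
  0     <⟨ s≤s z≤n ⟩
  1     ≡⟨ nCn≡1 k ⟨
  k C k ≤⟨ C-monoˡ-≤ k k≤n ⟩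
  n C k ∎
  where open ≤-Reasoning

mCk*nCl≤[m+n]C[k+l] : ∀ m n k l → (m C k) * (n C l) ≤ (m + n) C (k + l)
mCk*nCl≤[m+n]C[k+l] m       n zero    l = begin
  1 * (n C l)     ≡⟨ *-identityˡ (n C l) ⟩
  n C l           ≤⟨ C-monoˡ-≤ l (m≤n+m n m) ⟩
  (m + n) C l     ∎
  where open ≤-Reasoning
mCk*nCl≤[m+n]C[k+l] zero    n (suc k) l = z≤n
mCk*nCl≤[m+n]C[k+l] (suc m) n (suc k) l = begin
  (suc m C suc k) * (n C l)
    ≡⟨ cong (_* (n C l)) (nCk+nC[k+1]≡[n+1]C[k+1] m k) ⟨
  (m C k + m C suc k) * (n C l)
    ≡⟨ *-distribʳ-+ (n C l) (m C k) (m C suc k) ⟩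
  (m C k) * (n C l) + (m C suc k) * (n C l)
    ≤⟨ +-mono-≤ (mCk*nCl≤[m+n]C[k+l] m n k l) (mCk*nCl≤[m+n]C[k+l] m n (suc k) l) ⟩
  (m + n) C (k + l) + (m + n) C suc (k + l)
    ≡⟨ nCk+nC[k+1]≡[n+1]C[k+1] (m + n) (k + l) ⟩
  suc (m + n) C suc (k + l) ∎
  where open ≤-Reasoning

2*[1+n]C2≡[1+n]*n : ∀ n → 2 * (suc n C 2) ≡ suc n * n
2*[1+n]C2≡[1+n]*n zero    = refl
2*[1+n]C2≡[1+n]*n (suc n) = begin
  2 * ((2 + n) C 2)                ≡⟨ cong (2 *_) (nCk+nC[k+1]≡[n+1]C[k+1] (1 + n) 1) ⟨
  2 * ((1 + n) C 1 + (1 + n) C 2)  ≡⟨ cong (λ c → 2 * (c + (1 + n) C 2)) (nC1≡n (1 + n)) ⟩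
  2 * ((1 + n) + (1 + n) C 2)      ≡⟨ *-distribˡ-+ 2 (1 + n) ((1 + n) C 2) ⟩
  2 * (1 + n) + 2 * ((1 + n) C 2)  ≡⟨ cong (2 * (1 + n) +_) (2*[1+n]C2≡[1+n]*n n) ⟩
  2 * (1 + n) + (1 + n) * n        ≡⟨ expand n ⟩
  (2 + n) * (1 + n)                ∎
  where
  open ≡-Reasoning
  expand : ∀ n → 2 * (1 + n) + (1 + n) * n ≡ (2 + n) * (1 + n)
  expand = solve-∀

-- For k ≥ 3 this is C(k+1,2) C(k-1,k-3) ≤ C(2k,k-1); the small cases are computed.
[1+k]C2≤[k+k]C[k∸1] : ∀ k → suc k C 2 ≤ (k + k) C (k ∸ 1)
[1+k]C2≤[k+k]C[k∸1] 0 = z≤n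
[1+k]C2≤[k+k]C[k∸1] 1 = ≤-refl
[1+k]C2≤[k+k]C[k∸1] 2 = n≤1+n 3
[1+k]C2≤[k+k]C[k∸1] k@(suc (suc (suc r))) = begin
  suc k C 2                         ≤⟨ m≤m*n (suc k C 2) ((2 + r) C r) ⟩
  (suc k C 2) * ((2 + r) C r)       ≤⟨ mCk*nCl≤[m+n]C[k+l] (suc k) (2 + r) 2 r ⟩
  (suc k + (2 + r)) C (2 + r)       ≡⟨ cong (_C (2 + r)) (+-suc k (2 + r)) ⟨
  (k + k) C (2 + r)                 ∎
  where
  open ≤-Reasoning
  instance
    _ : NonZero ((2 + r) C r)
    _ = >-nonZero (k≤n⇒nCk>0 (m≤n+m r 2))

a<[1+k]C2⇒a*nCk<[n+[k+k]]C[m+[k∸1]] : ∀ {a m k n} → n ≡ m + k → a < suc k C 2 →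
  a * (n C k) < (n + (k + k)) C (m + (k ∸ 1))
a<[1+k]C2⇒a*nCk<[n+[k+k]]C[m+[k∸1]] {a} {m} {k} refl a<[1+k]C2 = begin-strict
  a * ((m + k) C k)                       <⟨ *-monoˡ-< ((m + k) C k) a<[1+k]C2 ⟩
  (suc k C 2) * ((m + k) C k)             ≤⟨ *-monoˡ-≤ ((m + k) C k) ([1+k]C2≤[k+k]C[k∸1] k) ⟩
  ((k + k) C (k ∸ 1)) * ((m + k) C k)     ≡⟨ cong (((k + k) C (k ∸ 1)) *_) [m+k]Ck≡[m+k]Cm ⟩
  ((k + k) C (k ∸ 1)) * ((m + k) C m)     ≡⟨ *-comm ((k + k) C (k ∸ 1)) ((m + k) C m) ⟩
  ((m + k) C m) * ((k + k) C (k ∸ 1))     ≤⟨ mCk*nCl≤[m+n]C[k+l] (m + k) (k + k) m (k ∸ 1) ⟩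
  (m + k + (k + k)) C (m + (k ∸ 1))       ∎
  where
  open ≤-Reasoning
  instance
    _ : NonZero ((m + k) C k)
    _ = >-nonZero (k≤n⇒nCk>0 (m≤n+m k m))
  [m+k]Ck≡[m+k]Cm : (m + k) C k ≡ (m + k) C m
  [m+k]Ck≡[m+k]Cm = trans (nCk≡nC[n∸k] (m≤n+m k m)) (cong ((m + k) C_) (m+n∸n≡m m k))

kk[1+n]≡1+3n[1+n] : ∀ n → kk (1 + n) ≡ 1 + 3 * (n * (1 + n))
kk[1+n]≡1+3n[1+n] n = begin
  3 * (1 + n) ^ 2 ∸ 3 * (1 + n) + 1                     ≡⟨ cong (λ x → x ∸ 3 * (1 + n) + 1) (split n) ⟩
  3 * (n * (1 + n)) + 3 * (1 + n) ∸ 3 * (1 + n) + 1     ≡⟨ cong (_+ 1) (m+n∸n≡m (3 * (n * (1 + n))) (3 * (1 + n))) ⟩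
  3 * (n * (1 + n)) + 1                                 ≡⟨ +-comm (3 * (n * (1 + n))) 1 ⟩
  1 + 3 * (n * (1 + n))                                 ∎
  where
  open ≡-Reasoning
  -- The ring solver does not see through _^_, so powers are written out.
  split : ∀ n → 3 * ((1 + n) * ((1 + n) * 1)) ≡ 3 * (n * (1 + n)) + 3 * (1 + n)
  split = solve-∀

[1+n]^3≡n^3+kk[1+n] : ∀ n → (1 + n) ^ 3 ≡ n ^ 3 + kk (1 + n)
[1+n]^3≡n^3+kk[1+n] n = trans (expand n) (cong (n ^ 3 +_) (sym (kk[1+n]≡1+3n[1+n] n)))
  where
  expand : ∀ n → (1 + n) * ((1 + n) * ((1 + n) * 1)) ≡ n * (n * (n * 1)) + (1 + 3 * (n * (1 + n)))
  expand = solve-∀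

[1+n]^3∸1≡n^3+[kk[1+n]∸1] : ∀ n → (1 + n) ^ 3 ∸ 1 ≡ n ^ 3 + (kk (1 + n) ∸ 1)
[1+n]^3∸1≡n^3+[kk[1+n]∸1] n = trans (cong (_∸ 1) ([1+n]^3≡n^3+kk[1+n] n)) (+-∸-assoc (n ^ 3) 1≤kk)
  where
  1≤kk : 1 ≤ kk (1 + n)
  1≤kk = subst (1 ≤_) (sym (kk[1+n]≡1+3n[1+n] n)) (s≤s z≤n)

[1+n]^3+6[1+n]^2∸6[1+n]+2≡[1+n]^3+[kk+kk] : ∀ n →
  (1 + n) ^ 3 + 6 * (1 + n) ^ 2 ∸ 6 * (1 + n) + 2 ≡ (1 + n) ^ 3 + (kk (1 + n) + kk (1 + n))
[1+n]^3+6[1+n]^2∸6[1+n]+2≡[1+n]^3+[kk+kk] n = begin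
  N + 6 * (1 + n) ^ 2 ∸ 6 * (1 + n) + 2                  ≡⟨ cong (λ x → x ∸ 6 * (1 + n) + 2) (split N n) ⟩
  N + 6 * (n * (1 + n)) + 6 * (1 + n) ∸ 6 * (1 + n) + 2  ≡⟨ cong (_+ 2) (m+n∸n≡m (N + 6 * (n * (1 + n))) (6 * (1 + n))) ⟩
  N + 6 * (n * (1 + n)) + 2                              ≡⟨ regroup N (n * (1 + n)) ⟩
  N + ((1 + 3 * (n * (1 + n))) + (1 + 3 * (n * (1 + n)))) ≡⟨ cong (λ k → N + (k + k)) (kk[1+n]≡1+3n[1+n] n) ⟨
  N + (kk (1 + n) + kk (1 + n))                           ∎
  where
  open ≡-Reasoning
  N : ℕ
  N = (1 + n) ^ 3
  split : ∀ N n → N + 6 * ((1 + n) * ((1 + n) * 1)) ≡ N + 6 * (n * (1 + n)) + 6 * (1 + n)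
  split = solve-∀
  regroup : ∀ N t → N + 6 * t + 2 ≡ N + ((1 + 3 * t) + (1 + 3 * t))
  regroup = solve-∀

2*n^3<[1+kk[n]]C2 : ∀ n → 2 ≤ n → 2 * n ^ 3 < suc (kk n) C 2
2*n^3<[1+kk[n]]C2 n@(suc (suc p)) (s≤s (s≤s z≤n)) = *-cancelˡ-< 2 (2 * n ^ 3) (suc (kk n) C 2) (begin-strict
  2 * (2 * n ^ 3)                                   <⟨ m<m+n (2 * (2 * n ^ 3)) (s≤s z≤n) ⟩
  2 * (2 * n ^ 3) + (24 + _)                        ≡⟨ expand p ⟩
  (2 + 3 * ((1 + p) * n)) * (1 + 3 * ((1 + p) * n)) ≡⟨ cong (λ k → suc k * k) (kk[1+n]≡1+3n[1+n] (1 + p)) ⟨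
  suc (kk n) * kk n                                 ≡⟨ 2*[1+n]C2≡[1+n]*n (kk n) ⟨
  2 * (suc (kk n) C 2)                              ∎)
  where
  open ≤-Reasoning
  expand : ∀ p → 2 * (2 * ((2 + p) * ((2 + p) * ((2 + p) * 1))))
                   + (24 + (9 * p * p * p * p + 50 * p * p * p + 102 * p * p + 87 * p))
               ≡ (2 + 3 * ((1 + p) * (2 + p))) * (1 + 3 * ((1 + p) * (2 + p)))
  expand = solve-∀

proposition3 : (n : ℕ) → 2 ≤ n →
    n ^ 3 * ((n ^ 3 ∸ fl1 n) C kk n + (n ^ 3 ∸ fl2 n) C kk n)
      < (n ^ 3 + 6 * n ^ 2 ∸ 6 * n + 2) C (n ^ 3 ∸ 1)
proposition3 n@(suc m) 2≤n@(s≤s (s≤s z≤n)) = begin-strict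
  n ^ 3 * ((n ^ 3 ∸ fl1 n) C k + (n ^ 3 ∸ fl2 n) C k)
    ≤⟨ *-monoʳ-≤ (n ^ 3) (+-mono-≤ ([N∸f]Ck≤NCk (fl1 n)) ([N∸f]Ck≤NCk (fl2 n))) ⟩
  n ^ 3 * (n ^ 3 C k + n ^ 3 C k)
    ≡⟨ x*[y+y]≡2*x*y (n ^ 3) (n ^ 3 C k) ⟩
  2 * n ^ 3 * (n ^ 3 C k)
    <⟨ a<[1+k]C2⇒a*nCk<[n+[k+k]]C[m+[k∸1]] {m = m ^ 3} {k = k} ([1+n]^3≡n^3+kk[1+n] m) (2*n^3<[1+kk[n]]C2 n 2≤n) ⟩
  (n ^ 3 + (k + k)) C (m ^ 3 + (k ∸ 1))
    ≡⟨ cong₂ _C_ ([1+n]^3+6[1+n]^2∸6[1+n]+2≡[1+n]^3+[kk+kk] m) ([1+n]^3∸1≡n^3+[kk[1+n]∸1] m) ⟨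
  (n ^ 3 + 6 * n ^ 2 ∸ 6 * n + 2) C (n ^ 3 ∸ 1) ∎
  where
  open ≤-Reasoning
  k : ℕ
  k = kk n
  [N∸f]Ck≤NCk : ∀ f → (n ^ 3 ∸ f) C k ≤ n ^ 3 C k
  [N∸f]Ck≤NCk f = C-monoˡ-≤ k (m∸n≤m (n ^ 3) f)
  x*[y+y]≡2*x*y : ∀ x y → x * (y + y) ≡ 2 * x * y
  x*[y+y]≡2*x*y = solve-∀
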